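{- Let $x$ be a complex number with $x\neq 0$ and $9x^2\neq 1$, fix a square root $\sqrt{9x^2-1}$, and put $\lambda(x)=3x+\sqrt{9x^2-1}$. Then for every integer $n\geq 1$: \begin{gather*} \sum_{k=1}^n{n\choose k}\frac{1+(-1)^{n-k}}{\bigl(\sqrt{9x^2-1}\bigr)^{k-1}}B_{k}(x)=\sum_{k=0}^n{n\choose k}\frac{1-(-1)^{n-k}}{\bigl(\sqrt{9x^2-1}\bigr)^k}C_k(x),\\ \sum_{k=0}^n{n\choose k}\frac{\lambda(x)+(-1)^{n-k}\lambda^{ -1}(x)}{\bigl(6x\sqrt{9x^2-1}\bigr)^{k-1}}B_{2k+1}(x)=6x\sum_{k=0}^n{n\choose k}\frac{\lambda(x)-(-1)^{n-k}\lambda^{ -1}(x)}{\bigl(6x\sqrt{9x^2-1}\bigr)^k}C_{2k+1}(x),\\ \sum_{k=1}^n{n\choose k}\frac{1+(-1)^{n-k}}{\bigl(6x\sqrt{9x^2-1}\bigr)^{k-1}}B_{2k}(x)=6x\sum_{k=0}^n{n\choose k}\frac{1-(-1)^{n-k}}{\bigl(6x\sqrt{9x^2-1}\bigr)^k}C_{2k}(x),\\ \sum_{k=0}^n{n\choose k}\frac{1+(-1)^{n-k}}{\bigl(6x\sqrt{9x^2-1}\bigr)^{k-1}}B_{2k+1}(x)=6x\sum_{k=0}^n{n\choose k}\frac{\lambda(x)-(-1)^{n-k}\lambda^{ -1}(x)}{\bigl(6x\sqrt{9x^2-1}\bigr)^{k}}C_{2k}(x),\\ \sum_{k=1}^n{n\choose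 k}\frac{\lambda(x)+(-1)^{n-k}\lambda^{ -1}(x)}{\bigl(6x\sqrt{9x^2-1}\bigr)^{k-1}}B_{2k}(x)=6x\sum_{k=0}^n{n\choose k}\frac{1-(-1)^{n-k}}{\bigl(6x\sqrt{9x^2-1}\bigr)^k}C_{2k+1}(x). \end{gather*}
   Context: The balancing polynomials $B_n(x)$ and Lucas-balancing polynomials $C_n(x)$, $n\geq 0$, are defined by the recurrence $u_n(x)=6xu_{n-1}(x)-u_{n-2}(x)$ for $n\geq 2$, with initial terms $B_0(x)=0$, $B_1(x)=1$ and $C_0(x)=1$, $C_1(x)=3x$. Note $\lambda(x)^{ -1}=3x-\sqrt{9x^2-1}$. The same choice of square root is used throughout. The conditions $x\neq0$, $9x^2\neq 1$ only ensure that the denominators are nonzero. -}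

module Defs where

open import Level using (_⊔_) renaming (suc to lsuc)
open import Algebra.Bundles using (CommutativeRing; Semiring)
import Algebra.Definitions.RawSemiring as RS
open import Data.Nat.Base using (ℕ; zero; suc)
open import Data.Product.Base using (∃)
open import Relation.Nullary using (¬_)

-- A field of characteristic zero, presented as a commutative ring with
-- 1 ≠ 0, multiplicative inverses of nonzero elements, and n·1 ≠ 0 for n ≥ 1.
-- (agda-stdlib has no complex numbers and no Field bundle.)
record CharZeroField c ℓ : Set (lsuc (c ⊔ ℓ)) where
  field
    commutativeRing : CommutativeRing c ℓ
  open CommutativeRing commutativeRing public
  open RS (Semiring.rawSemiring semiring) public using (_×_; _^_)
  field
    1≉0      : ¬ (1# ≈ 0#)
    inverse  : ∀ a → ¬ (a ≈ 0#) → ∃ λ b → a * b ≈ 1#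
    charZero : ∀ n → ¬ (suc n × 1# ≈ 0#)

module FieldOps {c ℓ} (F : CharZeroField c ℓ) where
  open CharZeroField F

  three six nine : Carrier
  three = 3 × 1#
  six   = 6 × 1#
  nine  = 9 × 1#

  sgn : ℕ → Carrier
  sgn m = (- 1#) ^ m

  Bal : Carrier → ℕ → Carrier
  Bal x zero = 0#
  Bal x (suc zero) = 1#
  Bal x (suc (suc n)) = six * x * Bal x (suc n) - Bal x n

  LBal : Carrier → ℕ → Carrier
  LBal x zero = 1#
  LBal x (suc zero) = three * x
  LBal x (suc (suc n)) = six * x * LBal x (suc n) - LBal x n

  Σ₀ : ℕ → (ℕ → Carrier) → Carrier
  Σ₀ zero f = f 0
  Σ₀ (suc n) f = Σ₀ n f + f (suc n)

  Σ₁ : ℕ → (ℕ → Carrier) → Carrier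
  Σ₁ zero f = 0#
  Σ₁ (suc n) f = Σ₁ n f + f (suc n)

{-# OPTIONS --safe #-}
module Submission where

open import Defs
open import Data.Nat.Base using (ℕ; suc; _≤_; _∸_) renaming (_*_ to _*ℕ_)
open import Data.Nat.Combinatorics using (_C_)
open import Data.Product.Base using (_×_)
open import Relation.Nullary using (¬_)

open import Algebra.Bundles using (CommutativeRing)
open import Algebra.Solver.Ring.AlmostCommutativeRing
  using (_-Raw-AlmostCommutative⟶_; fromCommutativeRing)
open import Data.Fin.Base using (toℕ)
open import Data.Integer.Base as ℤ using (ℤ; +_; -[1+_]; _⊖_; sign; ∣_∣; _◃_)
import Data.Integer.Properties as ℤ
open import Data.Maybe.Base using (Maybe; just; nothing)
open import Data.Nat.Base as ℕ using (zero)
import Data.Nat.Properties as ℕ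
open import Data.Product.Base using (_,_; proj₁; proj₂)
open import Data.Sign.Base as Sign using (Sign)
open import Relation.Nullary using (yes; no)
import Relation.Binary.PropositionalEquality as ≡

-- With λ = 3x + s and μ = λ⁻¹ = 3x − s, the Binet forms 2s·B_j = λ^j − μ^j and
-- 2·C_j = λ^j + μ^j turn each summand, multiplied by 2s, into
-- (p + q(−1)^(n−k)) a^k + (r + t(−1)^(n−k)) b^k, where (a, b) is (λ/s, μ/s) for the
-- first identity and (λ²/(6xs), μ²/(6xs)) for the others.  The binomial theorem
-- evaluates such a sum to p(a+1)^n + q(a−1)^n + r(b+1)^n + t(b−1)^n.  In all five
-- cases a − b = 2, so (a−1)^n = (b+1)^n, and the two sides differ only in how this
-- common value is distributed between the coefficients q and r.

-- Integer coefficients are interpreted through the optimised ℕ-multiple, under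
-- which ⟦ + 1 ⟧ is 1# itself, so con (+ 1) can stand for 1# in solver goals.  The
-- numerals of FieldOps use the other ℕ-multiple and are passed to the solver as
-- atoms, together with the relations between them proved below.
module IntegerCoefficients {c ℓ} (R : CommutativeRing c ℓ) where
  open CommutativeRing R
  open import Algebra.Properties.Semiring.Mult.TCOptimised semiring
    using (1+×; ×1-homo-*; ×-homo-+) renaming (_×_ to _×′_)
  open import Algebra.Properties.Ring ring using (-1*x≈-x)
  open import Algebra.Properties.AbelianGroup +-abelianGroup
    using (⁻¹-involutive; ε⁻¹≈ε; ⁻¹-∙-comm)
  open import Algebra.Properties.CommutativeSemigroup +-commutativeSemigroup
    using () renaming (interchange to +-interchange)
  open import Algebra.Properties.CommutativeSemigroup *-commutativeSemigroup
    using () renaming (interchange to *-interchange)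
  open import Relation.Binary.Reasoning.Setoid setoid

  ⟦_⟧ : ℤ → Carrier
  ⟦ + n ⟧     = n ×′ 1#
  ⟦ -[1+ n ] ⟧ = - (suc n ×′ 1#)

  ⟦⊖⟧ : ∀ m n → ⟦ m ⊖ n ⟧ ≈ m ×′ 1# - n ×′ 1#
  ⟦⊖⟧ m       zero    = sym (trans (+-congˡ ε⁻¹≈ε) (+-identityʳ _))
  ⟦⊖⟧ zero    (suc n) = sym (+-identityˡ _)
  ⟦⊖⟧ (suc m) (suc n) = begin
    ⟦ suc m ⊖ suc n ⟧                     ≡⟨ ≡.cong ⟦_⟧ (ℤ.[1+m]⊖[1+n]≡m⊖n m n) ⟩
    ⟦ m ⊖ n ⟧                             ≈⟨ ⟦⊖⟧ m n ⟩
    m ×′ 1# - n ×′ 1#                     ≈⟨ +-identityˡ _ ⟨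
    0# + (m ×′ 1# - n ×′ 1#)              ≈⟨ +-congʳ (-‿inverseʳ 1#) ⟨
    (1# - 1#) + (m ×′ 1# - n ×′ 1#)       ≈⟨ +-interchange _ _ _ _ ⟩
    (1# + m ×′ 1#) + (- 1# - n ×′ 1#)     ≈⟨ +-congˡ (⁻¹-∙-comm 1# (n ×′ 1#)) ⟩
    (1# + m ×′ 1#) - (1# + n ×′ 1#)       ≈⟨ +-cong (1+× m 1#) (-‿cong (1+× n 1#)) ⟨
    suc m ×′ 1# - suc n ×′ 1#             ∎

  ⟦+⟧ : ∀ i j → ⟦ i ℤ.+ j ⟧ ≈ ⟦ i ⟧ + ⟦ j ⟧
  ⟦+⟧ -[1+ m ] -[1+ n ] = begin
    - (suc (suc (m ℕ.+ n)) ×′ 1#)      ≡⟨ ≡.cong (λ k → - (k ×′ 1#)) (ℕ.+-suc (suc m) n) ⟨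
    - ((suc m ℕ.+ suc n) ×′ 1#)        ≈⟨ -‿cong (×-homo-+ 1# (suc m) (suc n)) ⟩
    - (suc m ×′ 1# + suc n ×′ 1#)      ≈⟨ ⁻¹-∙-comm _ _ ⟨
    - (suc m ×′ 1#) + - (suc n ×′ 1#)  ∎
  ⟦+⟧ -[1+ m ] (+ n)    = trans (⟦⊖⟧ n (suc m)) (+-comm _ _)
  ⟦+⟧ (+ m)    -[1+ n ] = ⟦⊖⟧ m (suc n)
  ⟦+⟧ (+ m)    (+ n)    = ×-homo-+ 1# m n

  ⟦_⟧ˢ : Sign → Carrier
  ⟦ Sign.+ ⟧ˢ = 1#
  ⟦ Sign.- ⟧ˢ = - 1#

  ⟦◃⟧ : ∀ σ n → ⟦ σ ◃ n ⟧ ≈ ⟦ σ ⟧ˢ * (n ×′ 1#)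
  ⟦◃⟧ σ      zero    = sym (zeroʳ _)
  ⟦◃⟧ Sign.+ (suc n) = sym (*-identityˡ _)
  ⟦◃⟧ Sign.- (suc n) = sym (-1*x≈-x _)

  ⟦⟧-sign-abs : ∀ i → ⟦ i ⟧ ≈ ⟦ sign i ⟧ˢ * (∣ i ∣ ×′ 1#)
  ⟦⟧-sign-abs (+ n)    = sym (*-identityˡ _)
  ⟦⟧-sign-abs -[1+ n ] = sym (-1*x≈-x _)

  ⟦*⟧ˢ : ∀ σ τ → ⟦ σ Sign.* τ ⟧ˢ ≈ ⟦ σ ⟧ˢ * ⟦ τ ⟧ˢ
  ⟦*⟧ˢ Sign.+ τ      = sym (*-identityˡ _)
  ⟦*⟧ˢ Sign.- Sign.+ = sym (*-identityʳ _)
  ⟦*⟧ˢ Sign.- Sign.- = sym (trans (-1*x≈-x (- 1#)) (⁻¹-involutive 1#))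

  ⟦*⟧ : ∀ i j → ⟦ i ℤ.* j ⟧ ≈ ⟦ i ⟧ * ⟦ j ⟧
  ⟦*⟧ i j = begin
    ⟦ sign i Sign.* sign j ◃ ∣ i ∣ ℕ.* ∣ j ∣ ⟧
      ≈⟨ ⟦◃⟧ (sign i Sign.* sign j) (∣ i ∣ ℕ.* ∣ j ∣) ⟩
    ⟦ sign i Sign.* sign j ⟧ˢ * ((∣ i ∣ ℕ.* ∣ j ∣) ×′ 1#)
      ≈⟨ *-cong (⟦*⟧ˢ (sign i) (sign j)) (×1-homo-* ∣ i ∣ ∣ j ∣) ⟩
    (⟦ sign i ⟧ˢ * ⟦ sign j ⟧ˢ) * ((∣ i ∣ ×′ 1#) * (∣ j ∣ ×′ 1#))
      ≈⟨ *-interchange _ _ _ _ ⟩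
    (⟦ sign i ⟧ˢ * (∣ i ∣ ×′ 1#)) * (⟦ sign j ⟧ˢ * (∣ j ∣ ×′ 1#))
      ≈⟨ *-cong (⟦⟧-sign-abs i) (⟦⟧-sign-abs j) ⟨
    ⟦ i ⟧ * ⟦ j ⟧ ∎

  ⟦-⟧ : ∀ i → ⟦ ℤ.- i ⟧ ≈ - ⟦ i ⟧
  ⟦-⟧ (+ zero)  = sym ε⁻¹≈ε
  ⟦-⟧ (+ suc n) = refl
  ⟦-⟧ -[1+ n ]  = sym (⁻¹-involutive _)

  homomorphism : ℤ.+-*-rawRing -Raw-AlmostCommutative⟶ fromCommutativeRing R
  homomorphism = record
    { ⟦_⟧ = ⟦_⟧ ; +-homo = ⟦+⟧ ; *-homo = ⟦*⟧ ; -‿homo = ⟦-⟧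
    ; 0-homo = refl ; 1-homo = refl }

  ⟦⟧-≟ : ∀ i j → Maybe (⟦ i ⟧ ≈ ⟦ j ⟧)
  ⟦⟧-≟ i j with i ℤ.≟ j
  ... | yes ≡.refl = just refl
  ... | no _       = nothing

  open import Algebra.Solver.Ring ℤ.+-*-rawRing (fromCommutativeRing R) homomorphism ⟦⟧-≟ public
    using (solve; _:=_; _:+_; _:*_; _:-_; :-_; con)

module _ {c ℓ} (F : CharZeroField c ℓ) where
  open CharZeroField F hiding (_×_)
  open FieldOps F
  open IntegerCoefficients commutativeRing
  open import Algebra.Properties.CommutativeMonoid.Mult +-commutativeMonoid using (×-distrib-+)
  open import Algebra.Properties.CommutativeSemigroup +-commutativeSemigroup
    using () renaming (interchange to +-interchange)
  open import Algebra.Properties.CommutativeSemigroup *-commutativeSemigroup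
    using () renaming (interchange to *-interchange)
  open import Algebra.Properties.CommutativeSemiring.Exp commutativeSemiring using (^-distrib-*)
  import Algebra.Properties.CommutativeSemiring.Binomial commutativeSemiring as Binomial
  open import Algebra.Properties.Monoid.Sum +-monoid
    using (sum; sum-replicate; sum-replicate-zero)
  open import Algebra.Properties.Ring ring using ([y-z]x≈yx-zx)
  open import Algebra.Properties.Semiring.Exp semiring using (^-congˡ; ^-assocʳ)
  open import Algebra.Properties.Semiring.Mult semiring
    using (×-comm-*; ×-congʳ; ×1-homo-*; ×-homo-+)
  open import Relation.Binary.Reasoning.Setoid setoid

  bin : ℕ → ℕ → Carrier → Carrier
  bin n k t = CharZeroField._×_ F (n C k) t

  two : Carrier
  two = CharZeroField._×_ F 2 1#

  two≈1+1 : two ≈ 1# + 1#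
  two≈1+1 = +-congˡ (+-identityʳ 1#)

  two*three≈six : two * three ≈ six
  two*three≈six = sym (×1-homo-* 2 3)

  three*three≈nine : three * three ≈ nine
  three*three≈nine = sym (×1-homo-* 3 3)

  three+three≈six : three + three ≈ six
  three+three≈six = sym (×-homo-+ 1# 3 3)

  half : Carrier
  half = proj₁ (inverse two (charZero 1))

  half*two≈1 : half * two ≈ 1#
  half*two≈1 = trans (*-comm half two) (proj₂ (inverse two (charZero 1)))

  *-cancelˡ-invertible : ∀ {K K′ X Y} → K′ * K ≈ 1# → K * X ≈ K * Y → X ≈ Y
  *-cancelˡ-invertible {K} {K′} {X} {Y} K′K≈1 KX≈KY = begin
    X             ≈⟨ *-identityˡ X ⟨
    1# * X        ≈⟨ *-congʳ K′K≈1 ⟨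
    K′ * K * X    ≈⟨ *-assoc K′ K X ⟩
    K′ * (K * X)  ≈⟨ *-congˡ KX≈KY ⟩
    K′ * (K * Y)  ≈⟨ *-assoc K′ K Y ⟨
    K′ * K * Y    ≈⟨ *-congʳ K′K≈1 ⟩
    1# * Y        ≈⟨ *-identityˡ Y ⟩
    Y             ∎

  1#^n≈1# : ∀ n → 1# ^ n ≈ 1#
  1#^n≈1# zero    = refl
  1#^n≈1# (suc n) = trans (*-identityˡ _) (1#^n≈1# n)

  x^k*y^k≈[xy]^k : ∀ x y k → x ^ k * y ^ k ≈ (x * y) ^ k
  x^k*y^k≈[xy]^k x y k = sym (^-distrib-* x y k)

  x^[2k]*y^k≈[xxy]^k : ∀ x y k → x ^ (2 *ℕ k) * y ^ k ≈ (x * x * y) ^ k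
  x^[2k]*y^k≈[xxy]^k x y k = begin
    x ^ (2 *ℕ k) * y ^ k   ≈⟨ *-congʳ (^-assocʳ x 2 k) ⟨
    (x ^ 2) ^ k * y ^ k    ≈⟨ *-congʳ (^-congˡ k (*-congˡ (*-identityʳ x))) ⟩
    (x * x) ^ k * y ^ k    ≈⟨ x^k*y^k≈[xy]^k (x * x) y k ⟩
    (x * x * y) ^ k        ∎

  x^[1+2k]*y^k≈x[xxy]^k : ∀ x y k → x ^ suc (2 *ℕ k) * y ^ k ≈ x * (x * x * y) ^ k
  x^[1+2k]*y^k≈x[xxy]^k x y k =
    trans (*-assoc x _ _) (*-congˡ (x^[2k]*y^k≈[xxy]^k x y k))

  [x-y]z≈u-v : ∀ {x y z u v} → x * z ≈ u → y * z ≈ v → (x - y) * z ≈ u - v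
  [x-y]z≈u-v xz≈u yz≈v = trans ([y-z]x≈yx-zx _ _ _) (+-cong xz≈u (-‿cong yz≈v))

  [x+y]z≈u+v : ∀ {x y z u v} → x * z ≈ u → y * z ≈ v → (x + y) * z ≈ u + v
  [x+y]z≈u+v xz≈u yz≈v = trans (distribʳ _ _ _) (+-cong xz≈u yz≈v)

  Σ₀-cong : ∀ n {f g : ℕ → Carrier} → (∀ k → f k ≈ g k) → Σ₀ n f ≈ Σ₀ n g
  Σ₀-cong zero    f≈g = f≈g 0
  Σ₀-cong (suc n) f≈g = +-cong (Σ₀-cong n f≈g) (f≈g (suc n))

  Σ₀-distrib-+ : ∀ n (f g : ℕ → Carrier) → Σ₀ n (λ k → f k + g k) ≈ Σ₀ n f + Σ₀ n g
  Σ₀-distrib-+ zero    f g = refl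
  Σ₀-distrib-+ (suc n) f g = trans (+-congʳ (Σ₀-distrib-+ n f g)) (+-interchange _ _ _ _)

  *-distribˡ-Σ₀ : ∀ n a (f : ℕ → Carrier) → a * Σ₀ n f ≈ Σ₀ n (λ k → a * f k)
  *-distribˡ-Σ₀ zero    a f = refl
  *-distribˡ-Σ₀ (suc n) a f = trans (distribˡ a _ _) (+-congʳ (*-distribˡ-Σ₀ n a f))

  Σ₀≈head+Σ₁ : ∀ n (f : ℕ → Carrier) → Σ₀ n f ≈ f 0 + Σ₁ n f
  Σ₀≈head+Σ₁ zero    f = sym (+-identityʳ _)
  Σ₀≈head+Σ₁ (suc n) f = trans (+-congʳ (Σ₀≈head+Σ₁ n f)) (+-assoc _ _ _)

  Σ₀-suc : ∀ n (f : ℕ → Carrier) → Σ₀ (suc n) f ≈ f 0 + Σ₀ n (λ k → f (suc k))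
  Σ₀-suc zero    f = refl
  Σ₀-suc (suc n) f = trans (+-congʳ (Σ₀-suc n f)) (+-assoc _ _ _)

  Σ₀≈sum : ∀ n (f : ℕ → Carrier) → Σ₀ n f ≈ sum {suc n} (λ i → f (toℕ i))
  Σ₀≈sum zero    f = sym (+-identityʳ _)
  Σ₀≈sum (suc n) f = trans (Σ₀-suc n f) (+-congˡ (Σ₀≈sum n (λ k → f (suc k))))

  Σ₀-binomial : ∀ n x y → Σ₀ n (λ k → bin n k (x ^ k * y ^ (n ∸ k))) ≈ (x + y) ^ n
  Σ₀-binomial n x y = trans (Σ₀≈sum n _) (sym (Binomial.theorem n x y))

  *-distribˡ-Σ₀-bin : ∀ n a (f : ℕ → Carrier) →
    a * Σ₀ n (λ k → bin n k (f k)) ≈ Σ₀ n (λ k → bin n k (a * f k))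
  *-distribˡ-Σ₀-bin n a f =
    trans (*-distribˡ-Σ₀ n a _) (Σ₀-cong n (λ k → ×-comm-* (n C k) a (f k)))

  Σ₁≈Σ₀-bin : ∀ n (f : ℕ → Carrier) → f 0 ≈ 0# →
    Σ₁ n (λ k → bin n k (f k)) ≈ Σ₀ n (λ k → bin n k (f k))
  Σ₁≈Σ₀-bin n f f₀≈0 = sym (begin
    Σ₀ n (λ k → bin n k (f k))                  ≈⟨ Σ₀≈head+Σ₁ n _ ⟩
    bin n 0 (f 0) + Σ₁ n (λ k → bin n k (f k))  ≈⟨ +-congʳ (×-congʳ (n C 0) f₀≈0) ⟩
    bin n 0 0# + Σ₁ n (λ k → bin n k (f k))     ≈⟨ +-congʳ multiple-of-zero ⟩
    0# + Σ₁ n (λ k → bin n k (f k))             ≈⟨ +-identityˡ _ ⟩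
    Σ₁ n (λ k → bin n k (f k))                  ∎)
    where
    multiple-of-zero : bin n 0 0# ≈ 0#
    multiple-of-zero = trans (sym (sum-replicate (n C 0))) (sum-replicate-zero (n C 0))

  signedPower : ℕ → Carrier → Carrier → Carrier → ℕ → Carrier
  signedPower n p q a k = (p + q * sgn (n ∸ k)) * a ^ k

  Σ₀-signedPower : ∀ n p q a →
    Σ₀ n (λ k → bin n k (signedPower n p q a k)) ≈ p * (a + 1#) ^ n + q * (a - 1#) ^ n
  Σ₀-signedPower n p q a = begin
    Σ₀ n (λ k → bin n k (signedPower n p q a k))
      ≈⟨ Σ₀-cong n split ⟩
    Σ₀ n (λ k → p * bin n k (a ^ k * 1# ^ (n ∸ k)) + q * bin n k (a ^ k * sgn (n ∸ k)))
      ≈⟨ Σ₀-distrib-+ n _ _ ⟩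
    Σ₀ n (λ k → p * bin n k (a ^ k * 1# ^ (n ∸ k))) + Σ₀ n (λ k → q * bin n k (a ^ k * sgn (n ∸ k)))
      ≈⟨ +-cong (*-distribˡ-Σ₀ n p _) (*-distribˡ-Σ₀ n q _) ⟨
    p * Σ₀ n (λ k → bin n k (a ^ k * 1# ^ (n ∸ k))) + q * Σ₀ n (λ k → bin n k (a ^ k * sgn (n ∸ k)))
      ≈⟨ +-cong (*-congˡ (Σ₀-binomial n a 1#)) (*-congˡ (Σ₀-binomial n a (- 1#))) ⟩
    p * (a + 1#) ^ n + q * (a - 1#) ^ n
      ∎
    where
    split : ∀ k → bin n k (signedPower n p q a k)
                ≈ p * bin n k (a ^ k * 1# ^ (n ∸ k)) + q * bin n k (a ^ k * sgn (n ∸ k))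
    split k = begin
      bin n k ((p + q * σ) * A)
        ≈⟨ ×-congʳ (n C k) (solve 4 (λ p q σ A → (p :+ q :* σ) :* A := p :* (A :* con (+ 1)) :+ q :* (A :* σ)) refl p q σ A) ⟩
      bin n k (p * (A * 1#) + q * (A * σ))
        ≈⟨ ×-congʳ (n C k) (+-congʳ (*-congˡ (*-congˡ (1#^n≈1# (n ∸ k))))) ⟨
      bin n k (p * (A * 1# ^ (n ∸ k)) + q * (A * σ))
        ≈⟨ ×-distrib-+ _ _ (n C k) ⟩
      bin n k (p * (A * 1# ^ (n ∸ k))) + bin n k (q * (A * σ))
        ≈⟨ +-cong (×-comm-* (n C k) p _) (×-comm-* (n C k) q _) ⟨
      p * bin n k (A * 1# ^ (n ∸ k)) + q * bin n k (A * σ)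
        ∎
      where
      σ A : Carrier
      σ = sgn (n ∸ k)
      A = a ^ k

  Σ₀-signedPower₂ : ∀ n p q r t a b →
    Σ₀ n (λ k → bin n k (signedPower n p q a k + signedPower n r t b k))
      ≈ (p * (a + 1#) ^ n + q * (a - 1#) ^ n) + (r * (b + 1#) ^ n + t * (b - 1#) ^ n)
  Σ₀-signedPower₂ n p q r t a b = begin
    Σ₀ n (λ k → bin n k (signedPower n p q a k + signedPower n r t b k))
      ≈⟨ Σ₀-cong n (λ k → ×-distrib-+ _ _ (n C k)) ⟩
    Σ₀ n (λ k → bin n k (signedPower n p q a k) + bin n k (signedPower n r t b k))
      ≈⟨ Σ₀-distrib-+ n _ _ ⟩
    Σ₀ n (λ k → bin n k (signedPower n p q a k)) + Σ₀ n (λ k → bin n k (signedPower n r t b k))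
      ≈⟨ +-cong (Σ₀-signedPower n p q a) (Σ₀-signedPower n r t b) ⟩
    (p * (a + 1#) ^ n + q * (a - 1#) ^ n) + (r * (b + 1#) ^ n + t * (b - 1#) ^ n)
      ∎

  binomial-transfer : ∀ n {a b} p q r t q′ r′ → a - 1# ≈ b + 1# → q + r ≈ q′ + r′ →
    Σ₀ n (λ k → bin n k (signedPower n p q a k + signedPower n r t b k))
      ≈ Σ₀ n (λ k → bin n k (signedPower n p q′ a k + signedPower n r′ t b k))
  binomial-transfer n {a} {b} p q r t q′ r′ a-1≈b+1 q+r≈q′+r′ = begin
    Σ₀ n (λ k → bin n k (signedPower n p q a k + signedPower n r t b k))
      ≈⟨ Σ₀-signedPower₂ n p q r t a b ⟩
    (p * A + q * X) + (r * Y + t * B)    ≈⟨ regroup q r ⟩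
    p * A + (q + r) * Y + t * B          ≈⟨ +-congʳ (+-congˡ (*-congʳ q+r≈q′+r′)) ⟩
    p * A + (q′ + r′) * Y + t * B        ≈⟨ regroup q′ r′ ⟨
    (p * A + q′ * X) + (r′ * Y + t * B)  ≈⟨ Σ₀-signedPower₂ n p q′ r′ t a b ⟨
    Σ₀ n (λ k → bin n k (signedPower n p q′ a k + signedPower n r′ t b k))
      ∎
    where
    A X Y B : Carrier
    A = (a + 1#) ^ n
    X = (a - 1#) ^ n
    Y = (b + 1#) ^ n
    B = (b - 1#) ^ n
    regroup : ∀ q r → (p * A + q * X) + (r * Y + t * B) ≈ p * A + (q + r) * Y + t * B
    regroup q r = trans (+-congʳ (+-congˡ (*-congˡ (^-congˡ n a-1≈b+1))))
      (solve 7 (λ p q r t A Y B → (p :* A :+ q :* Y) :+ (r :* Y :+ t :* B) := p :* A :+ (q :+ r) :* Y :+ t :* B)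
        refl p q r t A Y B)

  binomial-identity : ∀ n {f g : ℕ → Carrier} {K K′ a b} p q r t q′ r′ →
    K′ * K ≈ 1# → a - 1# ≈ b + 1# → q + r ≈ q′ + r′ →
    (∀ k → K * f k ≈ signedPower n p q a k + signedPower n r t b k) →
    (∀ k → K * g k ≈ signedPower n p q′ a k + signedPower n r′ t b k) →
    Σ₀ n (λ k → bin n k (f k)) ≈ Σ₀ n (λ k → bin n k (g k))
  binomial-identity n {f} {g} {K} {a = a} {b} p q r t q′ r′ K′K≈1 a-1≈b+1 q+r≈q′+r′ Kf≈ Kg≈ =
    *-cancelˡ-invertible K′K≈1 (begin
      K * Σ₀ n (λ k → bin n k (f k))
        ≈⟨ *-distribˡ-Σ₀-bin n K f ⟩
      Σ₀ n (λ k → bin n k (K * f k))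
        ≈⟨ Σ₀-cong n (λ k → ×-congʳ (n C k) (Kf≈ k)) ⟩
      Σ₀ n (λ k → bin n k (signedPower n p q a k + signedPower n r t b k))
        ≈⟨ binomial-transfer n p q r t q′ r′ a-1≈b+1 q+r≈q′+r′ ⟩
      Σ₀ n (λ k → bin n k (signedPower n p q′ a k + signedPower n r′ t b k))
        ≈⟨ Σ₀-cong n (λ k → ×-congʳ (n C k) (Kg≈ k)) ⟨
      Σ₀ n (λ k → bin n k (K * g k))
        ≈⟨ *-distribˡ-Σ₀-bin n K g ⟨
      K * Σ₀ n (λ k → bin n k (g k))
        ∎)

  second-order-recurrence : ∀ {p L M α β} (u : ℕ → Carrier) → L + M ≈ p → L * M ≈ 1# →
    (∀ k → u (suc (suc k)) ≈ p * u (suc k) - u k) →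
    u 0 ≈ α + β → u 1 ≈ α * L + β * M →
    ∀ k → u k ≈ α * L ^ k + β * M ^ k
  second-order-recurrence {p} {L} {M} {α} {β} u L+M≈p LM≈1 u-rec u₀≈ u₁≈ k = proj₁ (consecutive k)
    where
    closed : ℕ → Carrier
    closed k = α * L ^ k + β * M ^ k
    consecutive : ∀ k → u k ≈ closed k × u (suc k) ≈ closed (suc k)
    consecutive zero =
      trans u₀≈ (solve 2 (λ α β → α :+ β := α :* con (+ 1) :+ β :* con (+ 1)) refl α β) ,
      trans u₁≈ (solve 4 (λ α β L M → α :* L :+ β :* M := α :* (L :* con (+ 1)) :+ β :* (M :* con (+ 1))) refl α β L M)
    consecutive (suc k) = proj₂ (consecutive k) , (begin
      u (suc (suc k))                          ≈⟨ u-rec k ⟩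
      p * u (suc k) - u k                      ≈⟨ +-cong (*-cong (sym L+M≈p) (proj₂ (consecutive k))) (-‿cong (proj₁ (consecutive k))) ⟩
      (L + M) * closed (suc k) - closed k      ≈⟨ solve 6 (λ α β L M Lᵏ Mᵏ →
          (L :+ M) :* (α :* (L :* Lᵏ) :+ β :* (M :* Mᵏ)) :- (α :* Lᵏ :+ β :* Mᵏ)
            := α :* (L :* (L :* Lᵏ)) :+ β :* (M :* (M :* Mᵏ)) :+ (L :* M :- con (+ 1)) :* (α :* Lᵏ :+ β :* Mᵏ))
          refl α β L M (L ^ k) (M ^ k) ⟩
      closed (suc (suc k)) + (L * M - 1#) * closed k
        ≈⟨ +-congˡ (*-congʳ (trans (+-congʳ LM≈1) (-‿inverseʳ 1#))) ⟩
      closed (suc (suc k)) + 0# * closed k     ≈⟨ +-congˡ (zeroˡ _) ⟩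
      closed (suc (suc k)) + 0#                ≈⟨ +-identityʳ _ ⟩
      closed (suc (suc k))                     ∎)

  shift-by-two : ∀ {P Q t} → (P - Q) * t ≈ two → P * t - 1# ≈ Q * t + 1#
  shift-by-two {P} {Q} {t} [P-Q]t≈2 = begin
    P * t - 1#                 ≈⟨ solve 3 (λ P Q t → P :* t :- con (+ 1) := Q :* t :+ ((P :- Q) :* t :- con (+ 1))) refl P Q t ⟩
    Q * t + ((P - Q) * t - 1#) ≈⟨ +-congˡ (+-congʳ (trans [P-Q]t≈2 two≈1+1)) ⟩
    Q * t + (1# + 1# - 1#)     ≈⟨ +-congˡ (solve 0 (con (+ 1) :+ con (+ 1) :- con (+ 1) := con (+ 1)) refl) ⟩
    Q * t + 1#                 ∎

  module Balancing (x s : Carrier) (s²≈9x²-1 : s * s ≈ nine * x * x - 1#)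
                   (μ : Carrier) (λμ≈1 : (three * x + s) * μ ≈ 1#) where

    lam D : Carrier
    lam = three * x + s
    D   = six * x * s

    λ[3x-s]≈1 : lam * (three * x - s) ≈ 1#
    λ[3x-s]≈1 = begin
      lam * (three * x - s)                ≈⟨ solve 3 (λ T x s → (T :* x :+ s) :* (T :* x :- s) := T :* T :* x :* x :- s :* s) refl three x s ⟩
      three * three * x * x - s * s        ≈⟨ +-cong (*-congʳ (*-congʳ three*three≈nine)) (-‿cong s²≈9x²-1) ⟩
      nine * x * x - (nine * x * x - 1#)   ≈⟨ solve 1 (λ N → N :- (N :- con (+ 1)) := con (+ 1)) refl (nine * x * x) ⟩
      1#                                   ∎

    μ≈3x-s : μ ≈ three * x - s
    μ≈3x-s = *-cancelˡ-invertible {K = lam} (trans (*-comm μ lam) λμ≈1) (trans λμ≈1 (sym λ[3x-s]≈1))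

    λ+μ≈6x : lam + μ ≈ six * x
    λ+μ≈6x = begin
      lam + μ                   ≈⟨ +-congˡ μ≈3x-s ⟩
      lam + (three * x - s)     ≈⟨ solve 3 (λ T x s → (T :* x :+ s) :+ (T :* x :- s) := (T :+ T) :* x) refl three x s ⟩
      (three + three) * x       ≈⟨ *-congʳ three+three≈six ⟩
      six * x                   ∎

    λ-μ≈2s : lam - μ ≈ two * s
    λ-μ≈2s = begin
      lam - μ                   ≈⟨ +-congˡ (-‿cong μ≈3x-s) ⟩
      lam - (three * x - s)     ≈⟨ solve 3 (λ T x s → (T :* x :+ s) :- (T :* x :- s) := (con (+ 1) :+ con (+ 1)) :* s) refl three x s ⟩
      (1# + 1#) * s             ≈⟨ *-congʳ two≈1+1 ⟨
      two * s                   ∎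

    binet-Bal : ∀ j → two * s * Bal x j ≈ lam ^ j - μ ^ j
    binet-Bal j = trans
      (second-order-recurrence (λ j → two * s * Bal x j) λ+μ≈6x λμ≈1 recurrence u₀≈ u₁≈ j)
      (solve 2 (λ Λ M → con (+ 1) :* Λ :+ :- con (+ 1) :* M := Λ :- M) refl (lam ^ j) (μ ^ j))
      where
      recurrence : ∀ k → two * s * Bal x (suc (suc k)) ≈ six * x * (two * s * Bal x (suc k)) - two * s * Bal x k
      recurrence k = solve 5 (λ t s S B₁ B₀ → t :* s :* (S :* B₁ :- B₀) := S :* (t :* s :* B₁) :- t :* s :* B₀)
        refl two s (six * x) (Bal x (suc k)) (Bal x k)
      u₀≈ : two * s * 0# ≈ 1# + - 1#
      u₀≈ = solve 2 (λ t s → t :* s :* con (+ 0) := con (+ 1) :+ :- con (+ 1)) refl two s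
      u₁≈ : two * s * 1# ≈ 1# * lam + - 1# * μ
      u₁≈ = trans (*-identityʳ _) (trans (sym λ-μ≈2s)
        (solve 2 (λ Λ M → Λ :- M := con (+ 1) :* Λ :+ :- con (+ 1) :* M) refl lam μ))

    binet-LBal : ∀ j → two * LBal x j ≈ lam ^ j + μ ^ j
    binet-LBal j = trans
      (second-order-recurrence (λ j → two * LBal x j) λ+μ≈6x λμ≈1 recurrence u₀≈ u₁≈ j)
      (+-cong (*-identityˡ _) (*-identityˡ _))
      where
      recurrence : ∀ k → two * LBal x (suc (suc k)) ≈ six * x * (two * LBal x (suc k)) - two * LBal x k
      recurrence k = solve 4 (λ t S C₁ C₀ → t :* (S :* C₁ :- C₀) := S :* (t :* C₁) :- t :* C₀)
        refl two (six * x) (LBal x (suc k)) (LBal x k)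
      u₀≈ : two * 1# ≈ 1# + 1#
      u₀≈ = trans (*-identityʳ two) two≈1+1
      u₁≈ : two * (three * x) ≈ 1# * lam + 1# * μ
      u₁≈ = begin
        two * (three * x)     ≈⟨ *-assoc two three x ⟨
        two * three * x       ≈⟨ *-congʳ two*three≈six ⟩
        six * x               ≈⟨ λ+μ≈6x ⟨
        lam + μ               ≈⟨ +-cong (*-identityˡ lam) (*-identityˡ μ) ⟨
        1# * lam + 1# * μ     ∎

    Bal-sampled : ∀ t k → two * s * Bal x k * t ^ k ≈ (lam * t) ^ k - (μ * t) ^ k
    Bal-sampled t k = trans (*-congʳ (binet-Bal k))
      ([x-y]z≈u-v (x^k*y^k≈[xy]^k lam t k) (x^k*y^k≈[xy]^k μ t k))

    LBal-sampled : ∀ t k → two * LBal x k * t ^ k ≈ (lam * t) ^ k + (μ * t) ^ k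
    LBal-sampled t k = trans (*-congʳ (binet-LBal k))
      ([x+y]z≈u+v (x^k*y^k≈[xy]^k lam t k) (x^k*y^k≈[xy]^k μ t k))

    Bal-even-sampled : ∀ t k →
      two * s * Bal x (2 *ℕ k) * t ^ k ≈ (lam * lam * t) ^ k - (μ * μ * t) ^ k
    Bal-even-sampled t k = trans (*-congʳ (binet-Bal (2 *ℕ k)))
      ([x-y]z≈u-v (x^[2k]*y^k≈[xxy]^k lam t k) (x^[2k]*y^k≈[xxy]^k μ t k))

    LBal-even-sampled : ∀ t k →
      two * LBal x (2 *ℕ k) * t ^ k ≈ (lam * lam * t) ^ k + (μ * μ * t) ^ k
    LBal-even-sampled t k = trans (*-congʳ (binet-LBal (2 *ℕ k)))
      ([x+y]z≈u+v (x^[2k]*y^k≈[xxy]^k lam t k) (x^[2k]*y^k≈[xxy]^k μ t k))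

    Bal-odd-sampled : ∀ t k →
      two * s * Bal x (suc (2 *ℕ k)) * t ^ k ≈ lam * (lam * lam * t) ^ k - μ * (μ * μ * t) ^ k
    Bal-odd-sampled t k = trans (*-congʳ (binet-Bal (suc (2 *ℕ k))))
      ([x-y]z≈u-v (x^[1+2k]*y^k≈x[xxy]^k lam t k) (x^[1+2k]*y^k≈x[xxy]^k μ t k))

    LBal-odd-sampled : ∀ t k →
      two * LBal x (suc (2 *ℕ k)) * t ^ k ≈ lam * (lam * lam * t) ^ k + μ * (μ * μ * t) ^ k
    LBal-odd-sampled t k = trans (*-congʳ (binet-LBal (suc (2 *ℕ k))))
      ([x+y]z≈u+v (x^[1+2k]*y^k≈x[xxy]^k lam t k) (x^[1+2k]*y^k≈x[xxy]^k μ t k))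

    2s[c[ew]B]≈ec[2sBw] : ∀ c e w B → two * s * (c * (e * w) * B) ≈ e * c * (two * s * B * w)
    2s[c[ew]B]≈ec[2sBw] c e w B =
      solve 6 (λ t s c e w B → t :* s :* (c :* (e :* w) :* B) := e :* c :* (t :* s :* B :* w))
        refl two s c e w B

    2s[cwC]≈sc[2Cw] : ∀ c w C → two * s * (c * w * C) ≈ s * c * (two * C * w)
    2s[cwC]≈sc[2Cw] c w C =
      solve 5 (λ t s c w C → t :* s :* (c :* w :* C) := s :* c :* (t :* C :* w)) refl two s c w C

    2s[6x[cwC]]≈Dc[2Cw] : ∀ c w C → two * s * (six * x * (c * w * C)) ≈ D * c * (two * C * w)
    2s[6x[cwC]]≈Dc[2Cw] c w C =
      solve 7 (λ t s S x c w C → t :* s :* (S :* x :* (c :* w :* C)) := S :* x :* s :* c :* (t :* C :* w))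
        refl two s six x c w C

    module Identities (v d : Carrier) (sv≈1 : s * v ≈ 1#) (Dd≈1 : D * d ≈ 1#) where

      λv μv λ²d μ²d : Carrier
      λv  = lam * v
      μv  = μ * v
      λ²d = lam * lam * d
      μ²d = μ * μ * d

      half*v*2s≈1 : half * v * (two * s) ≈ 1#
      half*v*2s≈1 = begin
        half * v * (two * s)  ≈⟨ *-interchange half v two s ⟩
        half * two * (v * s)  ≈⟨ *-cong half*two≈1 (trans (*-comm v s) sv≈1) ⟩
        1# * 1#               ≈⟨ *-identityˡ 1# ⟩
        1#                    ∎

      λv-1≈μv+1 : λv - 1# ≈ μv + 1#
      λv-1≈μv+1 = shift-by-two (begin
        (lam - μ) * v   ≈⟨ *-congʳ λ-μ≈2s ⟩
        two * s * v     ≈⟨ *-assoc two s v ⟩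
        two * (s * v)   ≈⟨ *-congˡ sv≈1 ⟩
        two * 1#        ≈⟨ *-identityʳ two ⟩
        two             ∎)

      λ²d-1≈μ²d+1 : λ²d - 1# ≈ μ²d + 1#
      λ²d-1≈μ²d+1 = shift-by-two (begin
        (lam * lam - μ * μ) * d      ≈⟨ solve 3 (λ Λ M d → (Λ :* Λ :- M :* M) :* d := (Λ :- M) :* (Λ :+ M) :* d) refl lam μ d ⟩
        (lam - μ) * (lam + μ) * d    ≈⟨ *-congʳ (*-cong λ-μ≈2s λ+μ≈6x) ⟩
        two * s * (six * x) * d      ≈⟨ solve 5 (λ t s S x d → t :* s :* (S :* x) :* d := t :* (S :* x :* s :* d)) refl two s six x d ⟩
        two * (D * d)                ≈⟨ *-congˡ Dd≈1 ⟩
        two * 1#                     ≈⟨ *-identityʳ two ⟩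
        two                          ∎)

      Bal-LBal-identity : ∀ n →
        Σ₁ n (λ k → bin n k ((1# + sgn (n ∸ k)) * (s * v ^ k) * Bal x k))
          ≈ Σ₀ n (λ k → bin n k ((1# - sgn (n ∸ k)) * v ^ k * LBal x k))
      Bal-LBal-identity n = begin
        Σ₁ n (λ k → bin n k (f k))  ≈⟨ Σ₁≈Σ₀-bin n f (zeroʳ _) ⟩
        Σ₀ n (λ k → bin n k (f k))  ≈⟨ binomial-identity n s s (- s) (- s) (- s) s
                                         half*v*2s≈1 λv-1≈μv+1 (+-comm s (- s)) lhs rhs ⟩
        Σ₀ n (λ k → bin n k (g k))  ∎
        where
        f g : ℕ → Carrier
        f k = (1# + sgn (n ∸ k)) * (s * v ^ k) * Bal x k
        g k = (1# - sgn (n ∸ k)) * v ^ k * LBal x k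
        lhs : ∀ k → two * s * f k ≈ signedPower n s s λv k + signedPower n (- s) (- s) μv k
        lhs k = begin
          two * s * f k                                ≈⟨ 2s[c[ew]B]≈ec[2sBw] (1# + σ) s (v ^ k) _ ⟩
          s * (1# + σ) * (two * s * Bal x k * v ^ k)   ≈⟨ *-congˡ (Bal-sampled v k) ⟩
          s * (1# + σ) * (λv ^ k - μv ^ k)
            ≈⟨ solve 4 (λ s σ A B → s :* (con (+ 1) :+ σ) :* (A :- B)
                  := (s :+ s :* σ) :* A :+ (:- s :+ :- s :* σ) :* B) refl s σ (λv ^ k) (μv ^ k) ⟩
          signedPower n s s λv k + signedPower n (- s) (- s) μv k ∎
          where σ = sgn (n ∸ k)
        rhs : ∀ k → two * s * g k ≈ signedPower n s (- s) λv k + signedPower n s (- s) μv k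
        rhs k = begin
          two * s * g k                                ≈⟨ 2s[cwC]≈sc[2Cw] (1# - σ) (v ^ k) _ ⟩
          s * (1# - σ) * (two * LBal x k * v ^ k)      ≈⟨ *-congˡ (LBal-sampled v k) ⟩
          s * (1# - σ) * (λv ^ k + μv ^ k)
            ≈⟨ solve 4 (λ s σ A B → s :* (con (+ 1) :- σ) :* (A :+ B)
                  := (s :+ :- s :* σ) :* A :+ (s :+ :- s :* σ) :* B) refl s σ (λv ^ k) (μv ^ k) ⟩
          signedPower n s (- s) λv k + signedPower n s (- s) μv k ∎
          where σ = sgn (n ∸ k)

      Bal-odd-LBal-odd-identity : ∀ n →
        Σ₀ n (λ k → bin n k ((lam + sgn (n ∸ k) * μ) * (D * d ^ k) * Bal x (suc (2 *ℕ k))))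
          ≈ six * x * Σ₀ n (λ k → bin n k ((lam - sgn (n ∸ k) * μ) * d ^ k * LBal x (suc (2 *ℕ k))))
      Bal-odd-LBal-odd-identity n = begin
        Σ₀ n (λ k → bin n k (f k))            ≈⟨ binomial-identity n (D * lam * lam) (D * μ * lam) (- (D * lam * μ))
                                                   (- (D * μ * μ)) (- (D * μ * lam)) (D * lam * μ)
                                                   half*v*2s≈1 λ²d-1≈μ²d+1 balance lhs rhs ⟩
        Σ₀ n (λ k → bin n k (six * x * g k))  ≈⟨ *-distribˡ-Σ₀-bin n (six * x) g ⟨
        six * x * Σ₀ n (λ k → bin n k (g k))  ∎
        where
        f g : ℕ → Carrier
        f k = (lam + sgn (n ∸ k) * μ) * (D * d ^ k) * Bal x (suc (2 *ℕ k))
        g k = (lam - sgn (n ∸ k) * μ) * d ^ k * LBal x (suc (2 *ℕ k))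
        balance : D * μ * lam + - (D * lam * μ) ≈ - (D * μ * lam) + D * lam * μ
        balance = solve 3 (λ D Λ M → D :* M :* Λ :+ :- (D :* Λ :* M) := :- (D :* M :* Λ) :+ D :* Λ :* M) refl D lam μ
        lhs : ∀ k → two * s * f k
                  ≈ signedPower n (D * lam * lam) (D * μ * lam) λ²d k + signedPower n (- (D * lam * μ)) (- (D * μ * μ)) μ²d k
        lhs k = begin
          two * s * f k                                                ≈⟨ 2s[c[ew]B]≈ec[2sBw] (lam + σ * μ) D (d ^ k) _ ⟩
          D * (lam + σ * μ) * (two * s * Bal x (suc (2 *ℕ k)) * d ^ k) ≈⟨ *-congˡ (Bal-odd-sampled d k) ⟩
          D * (lam + σ * μ) * (lam * λ²d ^ k - μ * μ²d ^ k)
            ≈⟨ solve 6 (λ D Λ M σ A B → D :* (Λ :+ σ :* M) :* (Λ :* A :- M :* B)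
                  := (D :* Λ :* Λ :+ D :* M :* Λ :* σ) :* A :+ (:- (D :* Λ :* M) :+ :- (D :* M :* M) :* σ) :* B)
                refl D lam μ σ (λ²d ^ k) (μ²d ^ k) ⟩
          signedPower n (D * lam * lam) (D * μ * lam) λ²d k + signedPower n (- (D * lam * μ)) (- (D * μ * μ)) μ²d k ∎
          where σ = sgn (n ∸ k)
        rhs : ∀ k → two * s * (six * x * g k)
                  ≈ signedPower n (D * lam * lam) (- (D * μ * lam)) λ²d k + signedPower n (D * lam * μ) (- (D * μ * μ)) μ²d k
        rhs k = begin
          two * s * (six * x * g k)                                  ≈⟨ 2s[6x[cwC]]≈Dc[2Cw] (lam - σ * μ) (d ^ k) _ ⟩
          D * (lam - σ * μ) * (two * LBal x (suc (2 *ℕ k)) * d ^ k)  ≈⟨ *-congˡ (LBal-odd-sampled d k) ⟩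
          D * (lam - σ * μ) * (lam * λ²d ^ k + μ * μ²d ^ k)
            ≈⟨ solve 6 (λ D Λ M σ A B → D :* (Λ :- σ :* M) :* (Λ :* A :+ M :* B)
                  := (D :* Λ :* Λ :+ :- (D :* M :* Λ) :* σ) :* A :+ (D :* Λ :* M :+ :- (D :* M :* M) :* σ) :* B)
                refl D lam μ σ (λ²d ^ k) (μ²d ^ k) ⟩
          signedPower n (D * lam * lam) (- (D * μ * lam)) λ²d k + signedPower n (D * lam * μ) (- (D * μ * μ)) μ²d k ∎
          where σ = sgn (n ∸ k)

      Bal-even-LBal-even-identity : ∀ n →
        Σ₁ n (λ k → bin n k ((1# + sgn (n ∸ k)) * (D * d ^ k) * Bal x (2 *ℕ k)))
          ≈ six * x * Σ₀ n (λ k → bin n k ((1# - sgn (n ∸ k)) * d ^ k * LBal x (2 *ℕ k)))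
      Bal-even-LBal-even-identity n = begin
        Σ₁ n (λ k → bin n k (f k))            ≈⟨ Σ₁≈Σ₀-bin n f (zeroʳ _) ⟩
        Σ₀ n (λ k → bin n k (f k))            ≈⟨ binomial-identity n D D (- D) (- D) (- D) D
                                                   half*v*2s≈1 λ²d-1≈μ²d+1 (+-comm D (- D)) lhs rhs ⟩
        Σ₀ n (λ k → bin n k (six * x * g k))  ≈⟨ *-distribˡ-Σ₀-bin n (six * x) g ⟨
        six * x * Σ₀ n (λ k → bin n k (g k))  ∎
        where
        f g : ℕ → Carrier
        f k = (1# + sgn (n ∸ k)) * (D * d ^ k) * Bal x (2 *ℕ k)
        g k = (1# - sgn (n ∸ k)) * d ^ k * LBal x (2 *ℕ k)
        lhs : ∀ k → two * s * f k ≈ signedPower n D D λ²d k + signedPower n (- D) (- D) μ²d k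
        lhs k = begin
          two * s * f k                                       ≈⟨ 2s[c[ew]B]≈ec[2sBw] (1# + σ) D (d ^ k) _ ⟩
          D * (1# + σ) * (two * s * Bal x (2 *ℕ k) * d ^ k)   ≈⟨ *-congˡ (Bal-even-sampled d k) ⟩
          D * (1# + σ) * (λ²d ^ k - μ²d ^ k)
            ≈⟨ solve 4 (λ D σ A B → D :* (con (+ 1) :+ σ) :* (A :- B)
                  := (D :+ D :* σ) :* A :+ (:- D :+ :- D :* σ) :* B) refl D σ (λ²d ^ k) (μ²d ^ k) ⟩
          signedPower n D D λ²d k + signedPower n (- D) (- D) μ²d k ∎
          where σ = sgn (n ∸ k)
        rhs : ∀ k → two * s * (six * x * g k) ≈ signedPower n D (- D) λ²d k + signedPower n D (- D) μ²d k
        rhs k = begin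
          two * s * (six * x * g k)                        ≈⟨ 2s[6x[cwC]]≈Dc[2Cw] (1# - σ) (d ^ k) _ ⟩
          D * (1# - σ) * (two * LBal x (2 *ℕ k) * d ^ k)   ≈⟨ *-congˡ (LBal-even-sampled d k) ⟩
          D * (1# - σ) * (λ²d ^ k + μ²d ^ k)
            ≈⟨ solve 4 (λ D σ A B → D :* (con (+ 1) :- σ) :* (A :+ B)
                  := (D :+ :- D :* σ) :* A :+ (D :+ :- D :* σ) :* B) refl D σ (λ²d ^ k) (μ²d ^ k) ⟩
          signedPower n D (- D) λ²d k + signedPower n D (- D) μ²d k ∎
          where σ = sgn (n ∸ k)

      Bal-odd-LBal-even-identity : ∀ n →
        Σ₀ n (λ k → bin n k ((1# + sgn (n ∸ k)) * (D * d ^ k) * Bal x (suc (2 *ℕ k))))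
          ≈ six * x * Σ₀ n (λ k → bin n k ((lam - sgn (n ∸ k) * μ) * d ^ k * LBal x (2 *ℕ k)))
      Bal-odd-LBal-even-identity n = begin
        Σ₀ n (λ k → bin n k (f k))            ≈⟨ binomial-identity n (D * lam) (D * lam) (- (D * μ)) (- (D * μ))
                                                   (- (D * μ)) (D * lam) half*v*2s≈1 λ²d-1≈μ²d+1
                                                   (+-comm (D * lam) (- (D * μ))) lhs rhs ⟩
        Σ₀ n (λ k → bin n k (six * x * g k))  ≈⟨ *-distribˡ-Σ₀-bin n (six * x) g ⟨
        six * x * Σ₀ n (λ k → bin n k (g k))  ∎
        where
        f g : ℕ → Carrier
        f k = (1# + sgn (n ∸ k)) * (D * d ^ k) * Bal x (suc (2 *ℕ k))
        g k = (lam - sgn (n ∸ k) * μ) * d ^ k * LBal x (2 *ℕ k)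
        lhs : ∀ k → two * s * f k
                  ≈ signedPower n (D * lam) (D * lam) λ²d k + signedPower n (- (D * μ)) (- (D * μ)) μ²d k
        lhs k = begin
          two * s * f k                                             ≈⟨ 2s[c[ew]B]≈ec[2sBw] (1# + σ) D (d ^ k) _ ⟩
          D * (1# + σ) * (two * s * Bal x (suc (2 *ℕ k)) * d ^ k)   ≈⟨ *-congˡ (Bal-odd-sampled d k) ⟩
          D * (1# + σ) * (lam * λ²d ^ k - μ * μ²d ^ k)
            ≈⟨ solve 6 (λ D Λ M σ A B → D :* (con (+ 1) :+ σ) :* (Λ :* A :- M :* B)
                  := (D :* Λ :+ D :* Λ :* σ) :* A :+ (:- (D :* M) :+ :- (D :* M) :* σ) :* B)
                refl D lam μ σ (λ²d ^ k) (μ²d ^ k) ⟩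
          signedPower n (D * lam) (D * lam) λ²d k + signedPower n (- (D * μ)) (- (D * μ)) μ²d k ∎
          where σ = sgn (n ∸ k)
        rhs : ∀ k → two * s * (six * x * g k)
                  ≈ signedPower n (D * lam) (- (D * μ)) λ²d k + signedPower n (D * lam) (- (D * μ)) μ²d k
        rhs k = begin
          two * s * (six * x * g k)                             ≈⟨ 2s[6x[cwC]]≈Dc[2Cw] (lam - σ * μ) (d ^ k) _ ⟩
          D * (lam - σ * μ) * (two * LBal x (2 *ℕ k) * d ^ k)   ≈⟨ *-congˡ (LBal-even-sampled d k) ⟩
          D * (lam - σ * μ) * (λ²d ^ k + μ²d ^ k)
            ≈⟨ solve 6 (λ D Λ M σ A B → D :* (Λ :- σ :* M) :* (A :+ B)
                  := (D :* Λ :+ :- (D :* M) :* σ) :* A :+ (D :* Λ :+ :- (D :* M) :* σ) :* B)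
                refl D lam μ σ (λ²d ^ k) (μ²d ^ k) ⟩
          signedPower n (D * lam) (- (D * μ)) λ²d k + signedPower n (D * lam) (- (D * μ)) μ²d k ∎
          where σ = sgn (n ∸ k)

      Bal-even-LBal-odd-identity : ∀ n →
        Σ₁ n (λ k → bin n k ((lam + sgn (n ∸ k) * μ) * (D * d ^ k) * Bal x (2 *ℕ k)))
          ≈ six * x * Σ₀ n (λ k → bin n k ((1# - sgn (n ∸ k)) * d ^ k * LBal x (suc (2 *ℕ k))))
      Bal-even-LBal-odd-identity n = begin
        Σ₁ n (λ k → bin n k (f k))            ≈⟨ Σ₁≈Σ₀-bin n f (zeroʳ _) ⟩
        Σ₀ n (λ k → bin n k (f k))            ≈⟨ binomial-identity n (D * lam) (D * μ) (- (D * lam)) (- (D * μ))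
                                                   (- (D * lam)) (D * μ) half*v*2s≈1 λ²d-1≈μ²d+1
                                                   (+-comm (D * μ) (- (D * lam))) lhs rhs ⟩
        Σ₀ n (λ k → bin n k (six * x * g k))  ≈⟨ *-distribˡ-Σ₀-bin n (six * x) g ⟨
        six * x * Σ₀ n (λ k → bin n k (g k))  ∎
        where
        f g : ℕ → Carrier
        f k = (lam + sgn (n ∸ k) * μ) * (D * d ^ k) * Bal x (2 *ℕ k)
        g k = (1# - sgn (n ∸ k)) * d ^ k * LBal x (suc (2 *ℕ k))
        lhs : ∀ k → two * s * f k
                  ≈ signedPower n (D * lam) (D * μ) λ²d k + signedPower n (- (D * lam)) (- (D * μ)) μ²d k
        lhs k = begin
          two * s * f k                                          ≈⟨ 2s[c[ew]B]≈ec[2sBw] (lam + σ * μ) D (d ^ k) _ ⟩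
          D * (lam + σ * μ) * (two * s * Bal x (2 *ℕ k) * d ^ k) ≈⟨ *-congˡ (Bal-even-sampled d k) ⟩
          D * (lam + σ * μ) * (λ²d ^ k - μ²d ^ k)
            ≈⟨ solve 6 (λ D Λ M σ A B → D :* (Λ :+ σ :* M) :* (A :- B)
                  := (D :* Λ :+ D :* M :* σ) :* A :+ (:- (D :* Λ) :+ :- (D :* M) :* σ) :* B)
                refl D lam μ σ (λ²d ^ k) (μ²d ^ k) ⟩
          signedPower n (D * lam) (D * μ) λ²d k + signedPower n (- (D * lam)) (- (D * μ)) μ²d k ∎
          where σ = sgn (n ∸ k)
        rhs : ∀ k → two * s * (six * x * g k)
                  ≈ signedPower n (D * lam) (- (D * lam)) λ²d k + signedPower n (D * μ) (- (D * μ)) μ²d k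
        rhs k = begin
          two * s * (six * x * g k)                              ≈⟨ 2s[6x[cwC]]≈Dc[2Cw] (1# - σ) (d ^ k) _ ⟩
          D * (1# - σ) * (two * LBal x (suc (2 *ℕ k)) * d ^ k)   ≈⟨ *-congˡ (LBal-odd-sampled d k) ⟩
          D * (1# - σ) * (lam * λ²d ^ k + μ * μ²d ^ k)
            ≈⟨ solve 6 (λ D Λ M σ A B → D :* (con (+ 1) :- σ) :* (Λ :* A :+ M :* B)
                  := (D :* Λ :+ :- (D :* Λ) :* σ) :* A :+ (D :* M :+ :- (D :* M) :* σ) :* B)
                refl D lam μ σ (λ²d ^ k) (μ²d ^ k) ⟩
          signedPower n (D * lam) (- (D * lam)) λ²d k + signedPower n (D * μ) (- (D * μ)) μ²d k ∎
          where σ = sgn (n ∸ k)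

theorem5 : ∀ {c ℓ} (F : CharZeroField c ℓ) →
  let open CharZeroField F hiding (_×_)
      open FieldOps F
      bin : ℕ → ℕ → Carrier → Carrier
      bin n k t = CharZeroField._×_ F (n C k) t
  in
  ∀ (x s : Carrier) → ¬ (x ≈ 0#) → ¬ (nine * x * x ≈ 1#) →
  -- s is a (fixed) square root of 9x² - 1
  s * s ≈ nine * x * x - 1# →
  let lam = three * x + s
      D   = six * x * s
  in
  -- v = 1/s,  d = 1/(6x s),  μ = λ⁻¹ ;  1/D^(k-1) is written D * d^k
  ∀ (v d μ : Carrier) → s * v ≈ 1# → D * d ≈ 1# → lam * μ ≈ 1# →
  ∀ (n : ℕ) → 1 ≤ n →
    (Σ₁ n (λ k → bin n k ((1# + sgn (n ∸ k)) * (s * v ^ k) * Bal x k))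
       ≈ Σ₀ n (λ k → bin n k ((1# - sgn (n ∸ k)) * v ^ k * LBal x k)))
  × (Σ₀ n (λ k → bin n k ((lam + sgn (n ∸ k) * μ) * (D * d ^ k) * Bal x (suc (2 *ℕ k))))
       ≈ six * x * Σ₀ n (λ k → bin n k ((lam - sgn (n ∸ k) * μ) * d ^ k * LBal x (suc (2 *ℕ k)))))
  × (Σ₁ n (λ k → bin n k ((1# + sgn (n ∸ k)) * (D * d ^ k) * Bal x (2 *ℕ k)))
       ≈ six * x * Σ₀ n (λ k → bin n k ((1# - sgn (n ∸ k)) * d ^ k * LBal x (2 *ℕ k))))
  × (Σ₀ n (λ k → bin n k ((1# + sgn (n ∸ k)) * (D * d ^ k) * Bal x (suc (2 *ℕ k))))
       ≈ six * x * Σ₀ n (λ k → bin n k ((lam - sgn (n ∸ k) * μ) * d ^ k * LBal x (2 *ℕ k))))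
  × (Σ₁ n (λ k → bin n k ((lam + sgn (n ∸ k) * μ) * (D * d ^ k) * Bal x (2 *ℕ k)))
       ≈ six * x * Σ₀ n (λ k → bin n k ((1# - sgn (n ∸ k)) * d ^ k * LBal x (suc (2 *ℕ k)))))
theorem5 F x s _ _ s²≈9x²-1 v d μ sv≈1 Dd≈1 λμ≈1 n _ =
  Bal-LBal-identity n ,
  Bal-odd-LBal-odd-identity n ,
  Bal-even-LBal-even-identity n ,
  Bal-odd-LBal-even-identity n ,
  Bal-even-LBal-odd-identity n
  where open Balancing.Identities F x s s²≈9x²-1 μ λμ≈1 v d sv≈1 Dd≈1
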